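{- Let $k,l\in\mathbb{N}$ with $l\ge k/2$. Let $G$ be a graph with exactly $k$ edges and maximum degree at most $l$. Then $G$ contains at most $\binom{l}{2}+\binom{k-l+1}{2}$ happy triples.
   Context: For a graph $G$, a set $\{u,v,w\}\subseteq V(G)$ of three distinct vertices is a happy triple if the induced subgraph $G[\{u,v,w\}]$ has at least two edges. Graphs are simple (no loops or parallel edges). -}

module Defs where

open import Data.Nat using (ℕ; zero; suc; _+_; _≤_)
open import Data.Bool using (Bool; true; false; if_then_else_; _∧_)
open import Data.Fin using (Fin; _<?_)
open import Data.List using (List; map; allFin)
open import Data.Nat.ListAction using (sum)
open import Data.Nat using (_≤?_)
open import Relation.Nullary.Decidable using (⌊_⌋)
open import Relation.Binary.PropositionalEquality using (_≡_)

record SimpleGraph (n : ℕ) : Set where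
  field
    Adj   : Fin n → Fin n → Bool
    sym   : ∀ u v → Adj u v ≡ Adj v u
    irrfl : ∀ u → Adj u u ≡ false
open SimpleGraph public

b2n : Bool → ℕ
b2n true  = 1
b2n false = 0

count : {A : Set} → (A → Bool) → List A → ℕ
count p xs = sum (map (λ x → b2n (p x)) xs)

degree : {n : ℕ} → SimpleGraph n → Fin n → ℕ
degree G u = count (Adj G u) (allFin _)

edgeCount : {n : ℕ} → SimpleGraph n → ℕ
edgeCount {n} G =
  sum (map (λ u → count (λ v → ⌊ u <? v ⌋ ∧ Adj G u v) (allFin n)) (allFin n))

edgesIn : {n : ℕ} → SimpleGraph n → Fin n → Fin n → Fin n → ℕ
edgesIn G u v w = b2n (Adj G u v) + b2n (Adj G v w) + b2n (Adj G u w)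

Happy : {n : ℕ} → SimpleGraph n → Fin n → Fin n → Fin n → Set
Happy G u v w = 2 ≤ edgesIn G u v w

happyB : {n : ℕ} → SimpleGraph n → Fin n → Fin n → Fin n → Bool
happyB G u v w = ⌊ 2 ≤? edgesIn G u v w ⌋

happyCount : {n : ℕ} → SimpleGraph n → ℕ
happyCount {n} G =
  sum (map (λ u →
    sum (map (λ v →
      count (λ w → ⌊ u <? v ⌋ ∧ ⌊ v <? w ⌋ ∧ happyB G u v w) (allFin n))
    (allFin n)))
  (allFin n))

-- Let a be a vertex of maximum degree Δ and let H be G with the edges at a removed; H has k − Δ
-- edges. A happy triple through a contains two of its three possible edges: either both edges at a,
-- which happens for at most C(Δ,2) triples, or the edge opposite a, an edge of H that lies in only
-- one triple through a. Hence happy(G) ≤ happy(H) + C(Δ,2) + e(H). If Δ = l or e(H) < l, the crude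
-- bound happy(H) ≤ C(e(H),2), proved by the same recursion, suffices by convexity of C(·,2).
-- Otherwise all degrees of H are at most l − 1 and e(H) ≤ 2(l − 1), so induction on l applies to H.
-- A graph of maximum degree at most 1 has no happy triple, which settles Δ ≤ 1.
module Submission where

open import Defs hiding (sym)
open import Data.Nat using (ℕ; zero; suc; _+_; _*_; _∸_; _≤_; _<_; z≤n; s≤s; _≤?_)
open import Data.Nat.Combinatorics using (_C_; nC1≡n; nCk+nC[k+1]≡[n+1]C[k+1])
open import Data.Fin using (Fin; zero; suc; _≟_; _<?_)
open import Relation.Binary.PropositionalEquality
  using (_≡_; _≢_; refl; sym; trans; cong; cong₂; subst; module ≡-Reasoning)

open import Data.Nat.Properties hiding (_≟_; _<?_; suc-injective)
open import Algebra.Properties.CommutativeSemigroup +-commutativeSemigroup using (xy∙z≈xz∙y; xy∙z≈zy∙x)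
open import Algebra.Properties.Semiring.Sum +-*-semiring
  using (sum; sum-syntax; sum-cong-≗; sum-replicate-zero; ∑-distrib-+; *-distribˡ-sum)
open import Data.Bool using (Bool; true; false; _∧_; not)
open import Data.Fin.Properties using (suc-injective; toℕ-injective)
import Data.Fin.Properties as Finₚ
open import Data.List using (map; tabulate; allFin)
open import Data.List.Extrema.Nat using (argmax; f[xs]≤f[argmax])
open import Data.List.Membership.Propositional.Properties using (∈-allFin)
import Data.List.Relation.Unary.All as All
open import Data.Nat.Induction using (<-rec)
import Data.Nat.ListAction as List
open import Data.Nat.Tactic.RingSolver using (solve-∀)
open import Data.Product using (_×_; _,_)
open import Data.Sum using (_⊎_; inj₁; inj₂)
open import Function using (_∘_; id)
open import Relation.Nullary using (Dec; yes; no; contradiction)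
open import Relation.Nullary.Decidable using (⌊_⌋; ⌊⌋-map′)

𝟙[_] : {P : Set} → Dec P → ℕ
𝟙[ d ] = b2n ⌊ d ⌋

𝟙-yes : {P : Set} (d : Dec P) → P → 𝟙[ d ] ≡ 1
𝟙-yes (yes _) _ = refl
𝟙-yes (no ¬p) p = contradiction p ¬p

𝟙-refl-* : ∀ {n} (a : Fin n) x → 𝟙[ a ≟ a ] * x ≡ x
𝟙-refl-* a x = trans (cong (_* x) (𝟙-yes (a ≟ a) refl)) (*-identityˡ x)

b2n-∧ : ∀ x y → b2n (x ∧ y) ≡ b2n x * b2n y
b2n-∧ false y = refl
b2n-∧ true  y = sym (*-identityˡ (b2n y))

b2n-∧-∧ : ∀ x y z → b2n (x ∧ y ∧ z) ≡ b2n (x ∧ y) * b2n z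
b2n-∧-∧ false y     z = refl
b2n-∧-∧ true  false z = refl
b2n-∧-∧ true  true  z = sym (*-identityˡ (b2n z))

atLeastTwo : Bool → Bool → Bool → Bool
atLeastTwo x y z = ⌊ 2 ≤? b2n x + b2n y + b2n z ⌋

atLeastTwo-≤ : ∀ x y z → b2n (atLeastTwo x y z) ≤ b2n (x ∧ y) + b2n z
atLeastTwo-≤ true  true  true  = s≤s z≤n
atLeastTwo-≤ true  true  false = s≤s z≤n
atLeastTwo-≤ true  false true  = s≤s z≤n
atLeastTwo-≤ true  false false = z≤n
atLeastTwo-≤ false true  true  = s≤s z≤n
atLeastTwo-≤ false true  false = z≤n
atLeastTwo-≤ false false true  = z≤n
atLeastTwo-≤ false false false = z≤n

atLeastTwo-swap₂₃ : ∀ x y z → atLeastTwo x y z ≡ atLeastTwo x z y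
atLeastTwo-swap₂₃ x y z = cong (λ s → ⌊ 2 ≤? s ⌋) (xy∙z≈xz∙y (b2n x) (b2n y) (b2n z))

atLeastTwo-reverse : ∀ x y z → atLeastTwo x y z ≡ atLeastTwo z y x
atLeastTwo-reverse x y z = cong (λ s → ⌊ 2 ≤? s ⌋) (xy∙z≈zy∙x (b2n x) (b2n y) (b2n z))

<?-suc : ∀ {n} (x y : Fin n) → ⌊ suc x <? suc y ⌋ ≡ ⌊ x <? y ⌋
<?-suc x y = trans (⌊⌋-map′ _ _ _) (sym (⌊⌋-map′ _ _ _))

ordered : ∀ {n} → Fin n → Fin n → Fin n → Bool
ordered u v w = ⌊ u <? v ⌋ ∧ ⌊ v <? w ⌋

Distinct : ∀ {n} → Fin n → Fin n → Fin n → Set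
Distinct u v w = u ≢ v × v ≢ w × u ≢ w

ordered⇒distinct : ∀ {n} {u v w : Fin n} → ordered u v w ≡ true → Distinct u v w
ordered⇒distinct {u = u} {v} {w} uvw with u <? v | v <? w
ordered⇒distinct _  | yes u<v | yes v<w = Finₚ.<⇒≢ u<v , Finₚ.<⇒≢ v<w , Finₚ.<⇒≢ (<-trans u<v v<w)
ordered⇒distinct () | yes _   | no  _
ordered⇒distinct () | no  _   | _

ordered-gaps : ∀ {n} (a x y : Fin n) →
  b2n (ordered a x y) + b2n (ordered x a y) + b2n (ordered x y a) ≤ b2n ⌊ x <? y ⌋
ordered-gaps a x y with a <? x | x <? y | x <? a | a <? y | y <? a
... | yes a<x | yes x<y | _       | _       | yes y<a =
  contradiction (<-trans a<x (<-trans x<y y<a)) (<-irrefl refl)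
... | yes a<x | yes _   | yes x<a | _       | _       = contradiction a<x (<-asym x<a)
... | yes _   | yes _   | no  _   | _       | no  _   = ≤-refl
... | yes a<x | no  _   | yes x<a | _       | _       = contradiction a<x (<-asym x<a)
... | yes _   | no  _   | no  _   | _       | _       = z≤n
... | no  _   | yes _   | yes _   | yes a<y | yes y<a = contradiction a<y (<-asym y<a)
... | no  _   | yes _   | yes _   | yes _   | no  _   = ≤-refl
... | no  _   | yes _   | yes _   | no  _   | yes _   = ≤-refl
... | no  _   | yes _   | yes _   | no  _   | no  _   = z≤n
... | no  _   | yes _   | no  _   | _       | yes _   = ≤-refl
... | no  _   | yes _   | no  _   | _       | no  _   = z≤n
... | no  _   | no  x≮y | yes x<a | yes a<y | _       = contradiction (<-trans x<a a<y) x≮y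
... | no  _   | no  _   | yes _   | no  _   | _       = z≤n
... | no  _   | no  _   | no  _   | _       | _       = z≤n

sum-map-tabulate : ∀ {m} n (f : Fin m → ℕ) (g : Fin n → Fin m) →
                   List.sum (map f (tabulate g)) ≡ ∑[ i < n ] f (g i)
sum-map-tabulate zero    f g = refl
sum-map-tabulate (suc n) f g = cong (f (g zero) +_) (sum-map-tabulate n f (g ∘ suc))

count-allFin : ∀ {n} (p : Fin n → Bool) → count p (allFin n) ≡ ∑[ i < n ] b2n (p i)
count-allFin {n} p = sum-map-tabulate n (b2n ∘ p) id

∑-mono-≤ : ∀ {n} {f g : Fin n → ℕ} → (∀ i → f i ≤ g i) → sum f ≤ sum g
∑-mono-≤ {zero}  f≤g = z≤n
∑-mono-≤ {suc n} f≤g = +-mono-≤ (f≤g zero) (∑-mono-≤ (f≤g ∘ suc))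

∑-point : ∀ {n} (f : Fin n → ℕ) i → f i ≤ sum f
∑-point f zero    = m≤m+n _ _
∑-point f (suc i) = ≤-trans (∑-point (f ∘ suc) i) (m≤n+m _ _)

∑-two-points : ∀ {n} (f : Fin n → ℕ) {i j} → i ≢ j → f i + f j ≤ sum f
∑-two-points f {zero}  {zero}  i≢j = contradiction refl i≢j
∑-two-points f {zero}  {suc j} i≢j = +-monoʳ-≤ (f zero) (∑-point (f ∘ suc) j)
∑-two-points f {suc i} {zero}  i≢j =
  ≤-trans (≤-reflexive (+-comm (f (suc i)) (f zero))) (+-monoʳ-≤ (f zero) (∑-point (f ∘ suc) i))
∑-two-points f {suc i} {suc j} i≢j =
  ≤-trans (∑-two-points (f ∘ suc) (i≢j ∘ cong suc)) (m≤n+m _ _)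

∑-pull : ∀ {n} c (f : Fin n → ℕ) → ∑[ i < n ] (c * f i) ≡ c * sum f
∑-pull c f = sym (*-distribˡ-sum c f)

∑-𝟙≟ : ∀ {n} (f : Fin n → ℕ) a → ∑[ x < n ] (𝟙[ x ≟ a ] * f x) ≡ f a
∑-𝟙≟ {suc n} f zero = begin
  f zero + 0 + ∑[ x < n ] (0 * f (suc x)) ≡⟨ cong₂ _+_ (+-identityʳ (f zero)) (sum-replicate-zero n) ⟩
  f zero + 0                             ≡⟨ +-identityʳ (f zero) ⟩
  f zero                                 ∎
  where open ≡-Reasoning
∑-𝟙≟ {suc n} f (suc a) = begin
  ∑[ x < n ] (𝟙[ suc x ≟ suc a ] * f (suc x))
    ≡⟨ sum-cong-≗ (λ x → cong (λ b → b2n b * f (suc x)) (⌊⌋-map′ (cong suc) suc-injective (x ≟ a))) ⟩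
  ∑[ x < n ] (𝟙[ x ≟ a ] * f (suc x))
    ≡⟨ ∑-𝟙≟ (f ∘ suc) a ⟩
  f (suc a) ∎
  where open ≡-Reasoning

∑²-distrib-+ : ∀ {n} (f g : Fin n → Fin n → ℕ) →
  ∑[ x < n ] ∑[ y < n ] (f x y + g x y) ≡ ∑[ x < n ] ∑[ y < n ] f x y + ∑[ x < n ] ∑[ y < n ] g x y
∑²-distrib-+ {n} f g = trans (sum-cong-≗ {n} λ x → ∑-distrib-+ (f x) (g x))
  (∑-distrib-+ (λ x → ∑[ y < n ] f x y) (λ x → ∑[ y < n ] g x y))

∑³-distrib-+ : ∀ {n} (f g : Fin n → Fin n → Fin n → ℕ) →
  ∑[ u < n ] ∑[ v < n ] ∑[ w < n ] (f u v w + g u v w) ≡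
  ∑[ u < n ] ∑[ v < n ] ∑[ w < n ] f u v w + ∑[ u < n ] ∑[ v < n ] ∑[ w < n ] g u v w
∑³-distrib-+ {n} f g = trans (sum-cong-≗ {n} λ u → ∑²-distrib-+ (f u) (g u))
  (∑-distrib-+ (λ u → ∑[ v < n ] ∑[ w < n ] f u v w) (λ u → ∑[ v < n ] ∑[ w < n ] g u v w))

∑²-𝟙≟₁ : ∀ {n} a (F : Fin n → Fin n → ℕ) →
  ∑[ x < n ] ∑[ y < n ] (𝟙[ x ≟ a ] * F x y) ≡ ∑[ y < n ] F a y
∑²-𝟙≟₁ {n} a F = trans (sum-cong-≗ {n} λ x → ∑-pull 𝟙[ x ≟ a ] (F x)) (∑-𝟙≟ (λ x → ∑[ y < n ] F x y) a)

∑²-𝟙≟₂ : ∀ {n} a (F : Fin n → Fin n → ℕ) →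
  ∑[ x < n ] ∑[ y < n ] (𝟙[ y ≟ a ] * F x y) ≡ ∑[ x < n ] F x a
∑²-𝟙≟₂ {n} a F = sum-cong-≗ {n} λ x → ∑-𝟙≟ (F x) a

∑³-𝟙≟₁ : ∀ {n} a (F : Fin n → Fin n → Fin n → ℕ) →
  ∑[ u < n ] ∑[ v < n ] ∑[ w < n ] (𝟙[ u ≟ a ] * F u v w) ≡ ∑[ v < n ] ∑[ w < n ] F a v w
∑³-𝟙≟₁ {n} a F = trans (sum-cong-≗ {n} λ u → sum-cong-≗ {n} λ v → ∑-pull 𝟙[ u ≟ a ] (F u v))
                       (∑²-𝟙≟₁ a (λ u v → ∑[ w < n ] F u v w))

∑³-𝟙≟₂ : ∀ {n} a (F : Fin n → Fin n → Fin n → ℕ) →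
  ∑[ u < n ] ∑[ v < n ] ∑[ w < n ] (𝟙[ v ≟ a ] * F u v w) ≡ ∑[ u < n ] ∑[ w < n ] F u a w
∑³-𝟙≟₂ {n} a F = sum-cong-≗ {n} λ u → ∑²-𝟙≟₁ a (F u)

∑³-𝟙≟₃ : ∀ {n} a (F : Fin n → Fin n → Fin n → ℕ) →
  ∑[ u < n ] ∑[ v < n ] ∑[ w < n ] (𝟙[ w ≟ a ] * F u v w) ≡ ∑[ u < n ] ∑[ v < n ] F u v a
∑³-𝟙≟₃ {n} a F = sum-cong-≗ {n} λ u → ∑²-𝟙≟₂ a (F u)

C2-suc : ∀ n → suc n C 2 ≡ n + n C 2
C2-suc n = trans (sym (nCk+nC[k+1]≡[n+1]C[k+1] n 1)) (cong (_+ n C 2) (nC1≡n n))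

C2-mono : ∀ {m n} → m ≤ n → m C 2 ≤ n C 2
C2-mono {n = n} z≤n = z≤n
C2-mono {suc m} {suc n} (s≤s m≤n) = begin
  suc m C 2    ≡⟨ C2-suc m ⟩
  m + m C 2    ≤⟨ +-mono-≤ m≤n (C2-mono m≤n) ⟩
  n + n C 2    ≡⟨ C2-suc n ⟨
  suc n C 2    ∎
  where open ≤-Reasoning

C2-+ : ∀ m n → (m + n) C 2 ≡ m C 2 + n C 2 + m * n
C2-+ zero    n = sym (+-identityʳ (n C 2))
C2-+ (suc m) n = begin
  suc (m + n) C 2                           ≡⟨ C2-suc (m + n) ⟩
  m + n + (m + n) C 2                       ≡⟨ cong (m + n +_) (C2-+ m n) ⟩
  m + n + (m C 2 + n C 2 + m * n)           ≡⟨ rearrange m n (m C 2) (n C 2) ⟩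
  m + m C 2 + n C 2 + (n + m * n)           ≡⟨ cong (λ c → c + n C 2 + (n + m * n)) (C2-suc m) ⟨
  suc m C 2 + n C 2 + suc m * n             ∎
  where
  open ≡-Reasoning
  rearrange : ∀ m n x y → m + n + (x + y + m * n) ≡ m + x + y + (n + m * n)
  rearrange = solve-∀

C2-+-≥ : ∀ m {d} → 1 ≤ d → m C 2 + d C 2 + m ≤ (m + d) C 2
C2-+-≥ m {d} 1≤d = begin
  m C 2 + d C 2 + m        ≡⟨ cong (m C 2 + d C 2 +_) (*-identityʳ m) ⟨
  m C 2 + d C 2 + m * 1    ≤⟨ +-monoʳ-≤ (m C 2 + d C 2) (*-monoʳ-≤ m 1≤d) ⟩
  m C 2 + d C 2 + m * d    ≡⟨ C2-+ m d ⟨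
  (m + d) C 2              ∎
  where open ≤-Reasoning

C2-spread : ∀ {x y} t → y ≤ x → x C 2 + (y + t) C 2 ≤ (x + t) C 2 + y C 2
C2-spread {x} {y} t y≤x = begin
  x C 2 + (y + t) C 2                 ≡⟨ cong (x C 2 +_) (C2-+ y t) ⟩
  x C 2 + (y C 2 + t C 2 + y * t)     ≤⟨ +-monoʳ-≤ (x C 2) (+-monoʳ-≤ (y C 2 + t C 2) (*-monoˡ-≤ t y≤x)) ⟩
  x C 2 + (y C 2 + t C 2 + x * t)     ≡⟨ rearrange (x C 2) (y C 2) (t C 2) (x * t) ⟩
  x C 2 + t C 2 + x * t + y C 2       ≡⟨ cong (_+ y C 2) (C2-+ x t) ⟨
  (x + t) C 2 + y C 2                 ∎
  where
  open ≤-Reasoning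
  rearrange : ∀ a b c d → a + (b + c + d) ≡ a + c + d + b
  rearrange = solve-∀

C2-spread-to : ∀ {x y l} → x ≤ l → y ≤ l → x C 2 + y C 2 ≤ l C 2 + ((x + y) ∸ l) C 2
C2-spread-to {x} {y} {l} x≤l y≤l with m≤n⇒∃[o]m+o≡n x≤l | ≤-total l (x + y)
... | t , refl | inj₂ x+y≤l = begin
  x C 2 + y C 2                  ≤⟨ m≤m+n _ (x * y) ⟩
  x C 2 + y C 2 + x * y          ≡⟨ C2-+ x y ⟨
  (x + y) C 2                    ≤⟨ C2-mono x+y≤l ⟩
  (x + t) C 2                    ≤⟨ m≤m+n _ _ ⟩
  (x + t) C 2 + ((x + y) ∸ (x + t)) C 2 ∎
  where open ≤-Reasoning
... | t , refl | inj₁ l≤x+y with m≤n⇒∃[o]m+o≡n (+-cancelˡ-≤ x t y l≤x+y)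
...   | r , refl = begin
  x C 2 + (t + r) C 2            ≡⟨ cong (λ s → x C 2 + s C 2) (+-comm t r) ⟩
  x C 2 + (r + t) C 2            ≤⟨ C2-spread t r≤x ⟩
  (x + t) C 2 + r C 2            ≡⟨ cong (λ s → (x + t) C 2 + s C 2) x+[t+r]∸[x+t]≡r ⟨
  (x + t) C 2 + ((x + (t + r)) ∸ (x + t)) C 2 ∎
  where
  open ≤-Reasoning
  r≤x : r ≤ x
  r≤x = +-cancelʳ-≤ t r x (≤-trans (≤-reflexive (+-comm r t)) y≤l)
  x+[t+r]∸[x+t]≡r : (x + (t + r)) ∸ (x + t) ≡ r
  x+[t+r]∸[x+t]≡r = trans (cong (_∸ (x + t)) (sym (+-assoc x t r))) (m+n∸m≡n (x + t) r)

pairCount : ∀ {n} → (Fin n → Fin n → Bool) → ℕ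
pairCount {n} R = ∑[ x < n ] ∑[ y < n ] b2n (⌊ x <? y ⌋ ∧ R x y)

pairCount-suc : ∀ {n} (R : Fin (suc n) → Fin (suc n) → Bool) →
                pairCount R ≡ ∑[ y < n ] b2n (R zero (suc y)) + pairCount (λ x y → R (suc x) (suc y))
pairCount-suc {n} R = cong (∑[ y < n ] b2n (R zero (suc y)) +_) (sum-cong-≗ λ x → sum-cong-≗ λ y →
  cong (λ b → b2n (b ∧ R (suc x) (suc y))) (<?-suc x y))

pairCount-∧ : ∀ {n} (p : Fin n → Bool) → pairCount (λ x y → p x ∧ p y) ≡ (∑[ x < n ] b2n (p x)) C 2
pairCount-∧ {zero}  p = refl
pairCount-∧ {suc n} p with p zero | pairCount-suc (λ x y → p x ∧ p y) | pairCount-∧ (p ∘ suc)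
... | true  | first-row | rest = trans first-row (trans (cong (c +_) rest) (sym (C2-suc c)))
  where c = ∑[ x < n ] b2n (p (suc x))
... | false | first-row | rest = trans first-row (cong₂ _+_ (sum-replicate-zero n) rest)

oppositePairs : ∀ {n} → Fin n → (Fin n → Fin n → Bool) → Fin n → Fin n → Fin n → ℕ
oppositePairs a R u v w = 𝟙[ u ≟ a ] * b2n (R v w) + 𝟙[ v ≟ a ] * b2n (R u w) + 𝟙[ w ≟ a ] * b2n (R u v)

module _ {n : ℕ} (a : Fin n) (R : Fin n → Fin n → Bool) where

  oppositePairs₁ : ∀ v w → b2n (R v w) ≤ oppositePairs a R a v w
  oppositePairs₁ v w = ≤-trans (≤-reflexive (sym (𝟙-refl-* a _))) (≤-trans (m≤m+n _ _) (m≤m+n _ _))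

  oppositePairs₂ : ∀ u w → b2n (R u w) ≤ oppositePairs a R u a w
  oppositePairs₂ u w = ≤-trans (≤-reflexive (sym (𝟙-refl-* a _)))
    (≤-trans (m≤n+m _ (𝟙[ u ≟ a ] * b2n (R a w))) (m≤m+n _ _))

  oppositePairs₃ : ∀ u v → b2n (R u v) ≤ oppositePairs a R u v a
  oppositePairs₃ u v = ≤-trans (≤-reflexive (sym (𝟙-refl-* a _))) (m≤n+m _ _)

  triplesThrough : ℕ
  triplesThrough = ∑[ u < n ] ∑[ v < n ] ∑[ w < n ] (b2n (ordered u v w) * oppositePairs a R u v w)

  triplesThrough≤pairCount : triplesThrough ≤ pairCount R
  triplesThrough≤pairCount = begin
    triplesThrough
      ≡⟨ (sum-cong-≗ {n} λ u → sum-cong-≗ {n} λ v → sum-cong-≗ {n} λ w → distribute (b2n (ordered u v w))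
           𝟙[ u ≟ a ] 𝟙[ v ≟ a ] 𝟙[ w ≟ a ] (b2n (R v w)) (b2n (R u w)) (b2n (R u v))) ⟩
    ∑³ (λ u v w → T₁ u v w + T₂ u v w + T₃ u v w)
      ≡⟨ trans (∑³-distrib-+ (λ u v w → T₁ u v w + T₂ u v w) T₃) (cong (_+ ∑³ T₃) (∑³-distrib-+ T₁ T₂)) ⟩
    ∑³ T₁ + ∑³ T₂ + ∑³ T₃
      ≡⟨ cong₂ _+_ (cong₂ _+_ (∑³-𝟙≟₁ a F₁) (∑³-𝟙≟₂ a F₂)) (∑³-𝟙≟₃ a F₃) ⟩
    ∑² (λ x y → F₁ a x y) + ∑² (λ x y → F₂ x a y) + ∑² (λ x y → F₃ x y a)
      ≡⟨ trans (∑²-distrib-+ (λ x y → F₁ a x y + F₂ x a y) (λ x y → F₃ x y a))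
               (cong (_+ ∑² (λ x y → F₃ x y a)) (∑²-distrib-+ (λ x y → F₁ a x y) (λ x y → F₂ x a y))) ⟨
    ∑² (λ x y → F₁ a x y + F₂ x a y + F₃ x y a)
      ≤⟨ ∑-mono-≤ (λ x → ∑-mono-≤ λ y → gaps x y) ⟩
    ∑² (λ x y → b2n ⌊ x <? y ⌋ * b2n (R x y))
      ≡⟨ (sum-cong-≗ {n} λ x → sum-cong-≗ {n} λ y → b2n-∧ ⌊ x <? y ⌋ (R x y)) ⟨
    pairCount R ∎
    where
    open ≤-Reasoning
    ∑² : (Fin n → Fin n → ℕ) → ℕ
    ∑² f = ∑[ x < n ] ∑[ y < n ] f x y
    ∑³ : (Fin n → Fin n → Fin n → ℕ) → ℕ
    ∑³ f = ∑[ u < n ] ∑[ v < n ] ∑[ w < n ] f u v w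
    F₁ F₂ F₃ T₁ T₂ T₃ : Fin n → Fin n → Fin n → ℕ
    F₁ u v w = b2n (ordered u v w) * b2n (R v w)
    F₂ u v w = b2n (ordered u v w) * b2n (R u w)
    F₃ u v w = b2n (ordered u v w) * b2n (R u v)
    T₁ u v w = 𝟙[ u ≟ a ] * F₁ u v w
    T₂ u v w = 𝟙[ v ≟ a ] * F₂ u v w
    T₃ u v w = 𝟙[ w ≟ a ] * F₃ u v w
    distribute : ∀ o d e f x y z → o * (d * x + e * y + f * z) ≡ d * (o * x) + e * (o * y) + f * (o * z)
    distribute = solve-∀
    gaps : ∀ x y → F₁ a x y + F₂ x a y + F₃ x y a ≤ b2n ⌊ x <? y ⌋ * b2n (R x y)
    gaps x y = begin
      F₁ a x y + F₂ x a y + F₃ x y a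
        ≡⟨ trans (*-distribʳ-+ r (o₁ + o₂) o₃) (cong (_+ F₃ x y a) (*-distribʳ-+ r o₁ o₂)) ⟨
      (o₁ + o₂ + o₃) * r
        ≤⟨ *-monoˡ-≤ r (ordered-gaps a x y) ⟩
      b2n ⌊ x <? y ⌋ * r ∎
      where
      r = b2n (R x y)
      o₁ = b2n (ordered a x y)
      o₂ = b2n (ordered x a y)
      o₃ = b2n (ordered x y a)

module _ {n : ℕ} (G : SimpleGraph n) where

  degree≡∑ : ∀ u → degree G u ≡ ∑[ v < n ] b2n (Adj G u v)
  degree≡∑ u = count-allFin (Adj G u)

  edgeCount≡pairCount : edgeCount G ≡ pairCount (Adj G)
  edgeCount≡pairCount = trans (sum-map-tabulate n _ id) (sum-cong-≗ {n} λ u → count-allFin {n} _)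

  happyCount≡∑ : happyCount G ≡ ∑[ u < n ] ∑[ v < n ] ∑[ w < n ] (b2n (ordered u v w) * b2n (happyB G u v w))
  happyCount≡∑ = trans (sum-map-tabulate n _ id) (sum-cong-≗ {n} λ u →
    trans (sum-map-tabulate n _ id) (sum-cong-≗ {n} λ v →
    trans (count-allFin {n} _) (sum-cong-≗ {n} λ w → b2n-∧-∧ ⌊ u <? v ⌋ ⌊ v <? w ⌋ (happyB G u v w))))

  adj-by-order : ∀ a z → b2n ⌊ a <? z ⌋ * b2n (Adj G a z) + b2n ⌊ z <? a ⌋ * b2n (Adj G z a) ≡ b2n (Adj G a z)
  adj-by-order a z with a <? z | z <? a
  ... | yes a<z | yes z<a = contradiction a<z (<-asym z<a)
  ... | yes _   | no  _   = trans (+-identityʳ _) (*-identityˡ _)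
  ... | no  _   | yes _   = trans (*-identityˡ _) (cong b2n (SimpleGraph.sym G z a))
  ... | no  a≮z | no  z≮a = cong b2n (sym (trans (cong (Adj G a) z≡a) (irrfl G a)))
    where
    z≡a : z ≡ a
    z≡a = toℕ-injective (≤-antisym (≮⇒≥ a≮z) (≮⇒≥ z≮a))

  2≤degree : ∀ {x y z} → Adj G x y ≡ true → Adj G x z ≡ true → y ≢ z → 2 ≤ degree G x
  2≤degree {x} {y} {z} xy xz y≢z = begin
    2                                 ≡⟨ cong₂ (λ b c → b2n b + b2n c) xy xz ⟨
    b2n (Adj G x y) + b2n (Adj G x z) ≤⟨ ∑-two-points (b2n ∘ Adj G x) y≢z ⟩
    ∑[ t < n ] b2n (Adj G x t)        ≡⟨ degree≡∑ x ⟨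
    degree G x                        ∎
    where open ≤-Reasoning

  module _ (deg≤1 : ∀ x → degree G x ≤ 1) where

    private
      tooManyNeighbours : ∀ x → 2 ≤ degree G x → ∀ {A : Set} → A
      tooManyNeighbours x 2≤deg = contradiction (≤-trans 2≤deg (deg≤1 x)) (<-irrefl refl)

    unhappy : ∀ {u v w} → Distinct u v w → b2n (happyB G u v w) ≡ 0
    unhappy {u} {v} {w} (u≢v , v≢w , u≢w) with Adj G u v in uv | Adj G v w in vw | Adj G u w in uw
    ... | true  | true  | _     = tooManyNeighbours v (2≤degree (trans (SimpleGraph.sym G v u) uv) vw u≢w)
    ... | true  | false | true  = tooManyNeighbours u (2≤degree uv uw v≢w)
    ... | false | true  | true  =
      tooManyNeighbours w (2≤degree (trans (SimpleGraph.sym G w u) uw) (trans (SimpleGraph.sym G w v) vw) u≢v)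
    ... | true  | false | false = refl
    ... | false | true  | false = refl
    ... | false | false | true  = refl
    ... | false | false | false = refl

    happyCount≡0 : happyCount G ≡ 0
    happyCount≡0 = trans happyCount≡∑ (trans
      (sum-cong-≗ {n} λ u → trans (sum-cong-≗ {n} λ v → trans (sum-cong-≗ {n} λ w → ordered-unhappy u v w)
        (sum-replicate-zero n)) (sum-replicate-zero n))
      (sum-replicate-zero n))
      where
      ordered-unhappy : ∀ u v w → b2n (ordered u v w) * b2n (happyB G u v w) ≡ 0
      ordered-unhappy u v w with ordered u v w in uvw
      ... | false = refl
      ... | true  = trans (*-identityˡ _) (unhappy (ordered⇒distinct uvw))

isolate : ∀ {n} → SimpleGraph n → Fin n → SimpleGraph n
isolate {n} G a = record { Adj = adj ; sym = adj-sym ; irrfl = adj-irrfl }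
  where
  adj : Fin n → Fin n → Bool
  adj u v = not ⌊ u ≟ a ⌋ ∧ not ⌊ v ≟ a ⌋ ∧ Adj G u v
  adj-sym : ∀ u v → adj u v ≡ adj v u
  adj-sym u v with u ≟ a | v ≟ a
  ... | yes _ | yes _ = refl
  ... | yes _ | no  _ = refl
  ... | no  _ | yes _ = refl
  ... | no  _ | no  _ = SimpleGraph.sym G u v
  adj-irrfl : ∀ u → adj u u ≡ false
  adj-irrfl u with u ≟ a
  ... | yes _ = refl
  ... | no  _ = irrfl G u

module _ {n : ℕ} (G : SimpleGraph n) (a : Fin n) where

  private
    H : SimpleGraph n
    H = isolate G a
    N : Fin n → Fin n → Bool
    N x y = Adj G a x ∧ Adj G a y

  isolate-adj : ∀ {u v} → u ≢ a → v ≢ a → Adj H u v ≡ Adj G u v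
  isolate-adj {u} {v} u≢a v≢a with u ≟ a | v ≟ a
  ... | yes u≡a | _       = contradiction u≡a u≢a
  ... | no  _   | yes v≡a = contradiction v≡a v≢a
  ... | no  _   | no  _   = refl

  isolate-adj-≤ : ∀ u v → b2n (Adj H u v) ≤ b2n (Adj G u v)
  isolate-adj-≤ u v with u ≟ a | v ≟ a
  ... | yes _ | _     = z≤n
  ... | no  _ | yes _ = z≤n
  ... | no  _ | no  _ = ≤-refl

  degree-isolate : ∀ u → degree H u ≤ degree G u
  degree-isolate u = begin
    degree H u                  ≡⟨ degree≡∑ H u ⟩
    ∑[ v < n ] b2n (Adj H u v)  ≤⟨ ∑-mono-≤ (isolate-adj-≤ u) ⟩
    ∑[ v < n ] b2n (Adj G u v)  ≡⟨ degree≡∑ G u ⟨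
    degree G u                  ∎
    where open ≤-Reasoning

  -- With-abstracting x ≟ a also rewrites the tests inside Adj H, so every case computes.
  adj-isolate-split : ∀ x y → b2n (Adj G x y) ≡ b2n (Adj H x y) + (𝟙[ x ≟ a ] + 𝟙[ y ≟ a ]) * b2n (Adj G x y)
  adj-isolate-split x y with x ≟ a | y ≟ a
  ... | no  _    | no  _    = sym (+-identityʳ _)
  ... | yes refl | no  _    = sym (+-identityʳ _)
  ... | no  _    | yes refl = sym (+-identityʳ _)
  ... | yes refl | yes refl rewrite irrfl G x = refl

  edgeCount-isolate : edgeCount G ≡ edgeCount H + degree G a
  edgeCount-isolate = begin
    edgeCount G
      ≡⟨ edgeCount≡pairCount G ⟩
    ∑² (λ x y → b2n (⌊ x <? y ⌋ ∧ Adj G x y))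
      ≡⟨ (sum-cong-≗ {n} λ x → sum-cong-≗ {n} λ y → trans (b2n-∧ ⌊ x <? y ⌋ (Adj G x y))
           (trans (cong (l x y *_) (adj-isolate-split x y))
                  (rearrange (l x y) (b2n (Adj H x y)) 𝟙[ x ≟ a ] 𝟙[ y ≟ a ] (b2n (Adj G x y))))) ⟩
    ∑² (λ x y → pᴴ x y + (𝟙[ x ≟ a ] * e x y + 𝟙[ y ≟ a ] * e x y))
      ≡⟨ trans (∑²-distrib-+ pᴴ (λ x y → 𝟙[ x ≟ a ] * e x y + 𝟙[ y ≟ a ] * e x y))
               (cong (∑² pᴴ +_) (∑²-distrib-+ (λ x y → 𝟙[ x ≟ a ] * e x y) (λ x y → 𝟙[ y ≟ a ] * e x y))) ⟩
    ∑² pᴴ + (∑² (λ x y → 𝟙[ x ≟ a ] * e x y) + ∑² (λ x y → 𝟙[ y ≟ a ] * e x y))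
      ≡⟨ cong₂ _+_ (sum-cong-≗ {n} λ x → sum-cong-≗ {n} λ y → sym (b2n-∧ ⌊ x <? y ⌋ (Adj H x y)))
                   (trans (cong₂ _+_ (∑²-𝟙≟₁ a e) (∑²-𝟙≟₂ a e)) (sym (∑-distrib-+ (e a) (λ z → e z a)))) ⟩
    pairCount (Adj H) + ∑[ z < n ] (e a z + e z a)
      ≡⟨ cong₂ _+_ (edgeCount≡pairCount H) (trans (degree≡∑ G a) (sym (sum-cong-≗ {n} (adj-by-order G a)))) ⟨
    edgeCount H + degree G a ∎
    where
    open ≡-Reasoning
    ∑² : (Fin n → Fin n → ℕ) → ℕ
    ∑² f = ∑[ x < n ] ∑[ y < n ] f x y
    l e pᴴ : Fin n → Fin n → ℕ
    l x y = b2n ⌊ x <? y ⌋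
    e x y = l x y * b2n (Adj G x y)
    pᴴ x y = l x y * b2n (Adj H x y)
    rearrange : ∀ l h d d′ b → l * (h + (d + d′) * b) ≡ l * h + (d * (l * b) + d′ * (l * b))
    rearrange = solve-∀

  happy-through₁ : ∀ {v w} → v ≢ a → w ≢ a →
    b2n (happyB G a v w) ≤ oppositePairs a N a v w + oppositePairs a (Adj H) a v w
  happy-through₁ {v} {w} v≢a w≢a = begin
    b2n (atLeastTwo (Adj G a v) (Adj G v w) (Adj G a w))
      ≡⟨ cong b2n (atLeastTwo-swap₂₃ (Adj G a v) (Adj G v w) (Adj G a w)) ⟩
    b2n (atLeastTwo (Adj G a v) (Adj G a w) (Adj G v w))
      ≤⟨ atLeastTwo-≤ (Adj G a v) (Adj G a w) (Adj G v w) ⟩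
    b2n (N v w) + b2n (Adj G v w)
      ≡⟨ cong (λ b → b2n (N v w) + b2n b) (isolate-adj v≢a w≢a) ⟨
    b2n (N v w) + b2n (Adj H v w)
      ≤⟨ +-mono-≤ (oppositePairs₁ a N v w) (oppositePairs₁ a (Adj H) v w) ⟩
    oppositePairs a N a v w + oppositePairs a (Adj H) a v w ∎
    where open ≤-Reasoning

  happy-through₂ : ∀ {u w} → u ≢ a → w ≢ a →
    b2n (happyB G u a w) ≤ oppositePairs a N u a w + oppositePairs a (Adj H) u a w
  happy-through₂ {u} {w} u≢a w≢a = begin
    b2n (atLeastTwo (Adj G u a) (Adj G a w) (Adj G u w))
      ≡⟨ cong (λ b → b2n (atLeastTwo b (Adj G a w) (Adj G u w))) (SimpleGraph.sym G u a) ⟩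
    b2n (atLeastTwo (Adj G a u) (Adj G a w) (Adj G u w))
      ≤⟨ atLeastTwo-≤ (Adj G a u) (Adj G a w) (Adj G u w) ⟩
    b2n (N u w) + b2n (Adj G u w)
      ≡⟨ cong (λ b → b2n (N u w) + b2n b) (isolate-adj u≢a w≢a) ⟨
    b2n (N u w) + b2n (Adj H u w)
      ≤⟨ +-mono-≤ (oppositePairs₂ a N u w) (oppositePairs₂ a (Adj H) u w) ⟩
    oppositePairs a N u a w + oppositePairs a (Adj H) u a w ∎
    where open ≤-Reasoning

  happy-through₃ : ∀ {u v} → u ≢ a → v ≢ a →
    b2n (happyB G u v a) ≤ oppositePairs a N u v a + oppositePairs a (Adj H) u v a
  happy-through₃ {u} {v} u≢a v≢a = begin
    b2n (atLeastTwo (Adj G u v) (Adj G v a) (Adj G u a))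
      ≡⟨ cong₂ (λ b c → b2n (atLeastTwo (Adj G u v) b c)) (SimpleGraph.sym G v a) (SimpleGraph.sym G u a) ⟩
    b2n (atLeastTwo (Adj G u v) (Adj G a v) (Adj G a u))
      ≡⟨ cong b2n (atLeastTwo-reverse (Adj G u v) (Adj G a v) (Adj G a u)) ⟩
    b2n (atLeastTwo (Adj G a u) (Adj G a v) (Adj G u v))
      ≤⟨ atLeastTwo-≤ (Adj G a u) (Adj G a v) (Adj G u v) ⟩
    b2n (N u v) + b2n (Adj G u v)
      ≡⟨ cong (λ b → b2n (N u v) + b2n b) (isolate-adj u≢a v≢a) ⟨
    b2n (N u v) + b2n (Adj H u v)
      ≤⟨ +-mono-≤ (oppositePairs₃ a N u v) (oppositePairs₃ a (Adj H) u v) ⟩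
    oppositePairs a N u v a + oppositePairs a (Adj H) u v a ∎
    where open ≤-Reasoning

  happy-avoiding : ∀ {u v w} → u ≢ a → v ≢ a → w ≢ a → happyB H u v w ≡ happyB G u v w
  happy-avoiding u≢a v≢a w≢a rewrite isolate-adj u≢a v≢a | isolate-adj v≢a w≢a | isolate-adj u≢a w≢a = refl

  happy-isolate : ∀ {u v w} → Distinct u v w →
    b2n (happyB G u v w) ≤ b2n (happyB H u v w) + oppositePairs a N u v w + oppositePairs a (Adj H) u v w
  happy-isolate {u} {v} {w} (u≢v , v≢w , u≢w) = cases (u ≟ a) (v ≟ a) (w ≟ a)
    where
    h = b2n (happyB H u v w)
    cases : Dec (u ≡ a) → Dec (v ≡ a) → Dec (w ≡ a) →
      b2n (happyB G u v w) ≤ h + oppositePairs a N u v w + oppositePairs a (Adj H) u v w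
    cases (no u≢a)   (no v≢a)   (no w≢a)   =
      ≤-trans (≤-reflexive (cong b2n (sym (happy-avoiding u≢a v≢a w≢a)))) (≤-trans (m≤m+n _ _) (m≤m+n _ _))
    cases (yes refl) (no v≢a)   (no w≢a)   = ≤-trans (happy-through₁ v≢a w≢a) (+-monoˡ-≤ _ (m≤n+m _ h))
    cases (no u≢a)   (yes refl) (no w≢a)   = ≤-trans (happy-through₂ u≢a w≢a) (+-monoˡ-≤ _ (m≤n+m _ h))
    cases (no u≢a)   (no v≢a)   (yes refl) = ≤-trans (happy-through₃ u≢a v≢a) (+-monoˡ-≤ _ (m≤n+m _ h))
    cases (yes refl) (yes refl) _          = contradiction refl u≢v
    cases (yes refl) (no _)     (yes refl) = contradiction refl u≢w
    cases (no _)     (yes refl) (yes refl) = contradiction refl v≢w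

  happy-isolate-ordered : ∀ u v w →
    b2n (ordered u v w) * b2n (happyB G u v w) ≤
    b2n (ordered u v w) * b2n (happyB H u v w) + b2n (ordered u v w) * oppositePairs a N u v w
      + b2n (ordered u v w) * oppositePairs a (Adj H) u v w
  happy-isolate-ordered u v w with ordered u v w in uvw
  ... | false = z≤n
  ... | true  = begin
    1 * b2n (happyB G u v w) ≤⟨ *-monoʳ-≤ 1 (happy-isolate (ordered⇒distinct uvw)) ⟩
    1 * (h + p + q)          ≡⟨ trans (*-distribˡ-+ 1 (h + p) q) (cong (_+ 1 * q) (*-distribˡ-+ 1 h p)) ⟩
    1 * h + 1 * p + 1 * q    ∎
    where
    open ≤-Reasoning
    h = b2n (happyB H u v w)
    p = oppositePairs a N u v w
    q = oppositePairs a (Adj H) u v w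

  happyCount-isolate : happyCount G ≤ happyCount H + triplesThrough a N + triplesThrough a (Adj H)
  happyCount-isolate = begin
    happyCount G
      ≡⟨ happyCount≡∑ G ⟩
    ∑³ (λ u v w → o u v w * b2n (happyB G u v w))
      ≤⟨ ∑-mono-≤ (λ u → ∑-mono-≤ λ v → ∑-mono-≤ λ w → happy-isolate-ordered u v w) ⟩
    ∑³ (λ u v w → hᴴ u v w + tᴺ u v w + tᴴ u v w)
      ≡⟨ trans (∑³-distrib-+ (λ u v w → hᴴ u v w + tᴺ u v w) tᴴ) (cong (_+ ∑³ tᴴ) (∑³-distrib-+ hᴴ tᴺ)) ⟩
    ∑³ hᴴ + triplesThrough a N + triplesThrough a (Adj H)
      ≡⟨ cong (λ h → h + triplesThrough a N + triplesThrough a (Adj H)) (happyCount≡∑ H) ⟨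
    happyCount H + triplesThrough a N + triplesThrough a (Adj H) ∎
    where
    open ≤-Reasoning
    o hᴴ tᴺ tᴴ : Fin n → Fin n → Fin n → ℕ
    o u v w = b2n (ordered u v w)
    hᴴ u v w = o u v w * b2n (happyB H u v w)
    tᴺ u v w = o u v w * oppositePairs a N u v w
    tᴴ u v w = o u v w * oppositePairs a (Adj H) u v w
    ∑³ : (Fin n → Fin n → Fin n → ℕ) → ℕ
    ∑³ f = ∑[ u < n ] ∑[ v < n ] ∑[ w < n ] f u v w

  happyCount-isolate-≤ : happyCount G ≤ happyCount H + degree G a C 2 + edgeCount H
  happyCount-isolate-≤ =
    ≤-trans happyCount-isolate (+-mono-≤ (+-monoʳ-≤ (happyCount H) neighbourPairs) isolatedEdges)
    where
    neighbourPairs : triplesThrough a N ≤ degree G a C 2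
    neighbourPairs = ≤-trans (triplesThrough≤pairCount a N)
      (≤-reflexive (trans (pairCount-∧ (Adj G a)) (cong (_C 2) (sym (degree≡∑ G a)))))
    isolatedEdges : triplesThrough a (Adj H) ≤ edgeCount H
    isolatedEdges = ≤-trans (triplesThrough≤pairCount a (Adj H)) (≤-reflexive (sym (edgeCount≡pairCount H)))

module _ {n : ℕ} (G : SimpleGraph (suc n)) where

  maxDegreeVertex : Fin (suc n)
  maxDegreeVertex = argmax (degree G) zero (allFin (suc n))

  degree≤maxDegree : ∀ u → degree G u ≤ degree G maxDegreeVertex
  degree≤maxDegree u = All.lookup (f[xs]≤f[argmax] {f = degree G} zero (allFin (suc n))) (∈-allFin u)

module IsolateMaxDegree {n : ℕ} (G : SimpleGraph (suc n)) where

  a : Fin (suc n)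
  a = maxDegreeVertex G

  H : SimpleGraph (suc n)
  H = isolate G a

  Δ m : ℕ
  Δ = degree G a
  m = edgeCount H

  k≡m+Δ : edgeCount G ≡ m + Δ
  k≡m+Δ = edgeCount-isolate G a

  degreeH≤Δ : ∀ v → degree H v ≤ Δ
  degreeH≤Δ v = ≤-trans (degree-isolate G a v) (degree≤maxDegree G v)

  Δ≤1⇒happyCount≡0 : Δ ≤ 1 → happyCount G ≡ 0
  Δ≤1⇒happyCount≡0 Δ≤1 = happyCount≡0 G λ u → ≤-trans (degree≤maxDegree G u) Δ≤1

-- The case splits below go through helper functions on Dec values: a with-abstraction would
-- normalise the binomial coefficients in the goal, which is prohibitively slow.
happyCount≤C2 : ∀ {n} (G : SimpleGraph n) → happyCount G ≤ edgeCount G C 2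
happyCount≤C2 G = <-rec P step (edgeCount G) G refl
  where
  P : ℕ → Set
  P k = ∀ {n} (G : SimpleGraph n) → edgeCount G ≡ k → happyCount G ≤ k C 2
  step : ∀ k → (∀ {j} → j < k → P j) → P k
  step k rec {zero}  G _    = z≤n
  step k rec {suc n} G refl = removeMax (Δ ≤? 1)
    where
    open IsolateMaxDegree G
    open ≤-Reasoning
    removeMax : Dec (Δ ≤ 1) → happyCount G ≤ edgeCount G C 2
    removeMax (yes Δ≤1) = ≤-trans (≤-reflexive (Δ≤1⇒happyCount≡0 Δ≤1)) z≤n
    removeMax (no  Δ≰1) = begin
      happyCount G                 ≤⟨ happyCount-isolate-≤ G a ⟩
      happyCount H + Δ C 2 + m     ≤⟨ +-monoˡ-≤ m (+-monoˡ-≤ (Δ C 2) (rec m<k H refl)) ⟩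
      m C 2 + Δ C 2 + m            ≤⟨ C2-+-≥ m 1≤Δ ⟩
      (m + Δ) C 2                  ≡⟨ cong (_C 2) k≡m+Δ ⟨
      edgeCount G C 2              ∎
      where
      1≤Δ : 1 ≤ Δ
      1≤Δ = ≤-trans (n≤1+n 1) (≰⇒> Δ≰1)
      m<k : m < edgeCount G
      m<k = ≤-trans (m<m+n m 1≤Δ) (≤-reflexive (sym k≡m+Δ))

happyBound : ℕ → ℕ → ℕ
happyBound k l = l C 2 + ((k + 1) ∸ l) C 2

happyBound-star : ∀ {m Δ l} → Δ ≤ l → (Δ ≡ l) ⊎ (suc m ≤ l) → m C 2 + Δ C 2 + m ≤ happyBound (m + Δ) l
happyBound-star {m} {Δ} {l} Δ≤l Δ≡l⊎m<l = begin
  m C 2 + Δ C 2 + m              ≡⟨ rearrange (m C 2) (Δ C 2) m ⟩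
  Δ C 2 + (m + m C 2)            ≡⟨ cong (Δ C 2 +_) (C2-suc m) ⟨
  Δ C 2 + suc m C 2              ≤⟨ spread Δ≡l⊎m<l ⟩
  l C 2 + ((Δ + suc m) ∸ l) C 2  ≡⟨ cong (λ s → l C 2 + (s ∸ l) C 2) (m+Δ+1≡Δ+[1+m] m Δ) ⟨
  happyBound (m + Δ) l           ∎
  where
  open ≤-Reasoning
  rearrange : ∀ x y m → x + y + m ≡ y + (m + x)
  rearrange = solve-∀
  m+Δ+1≡Δ+[1+m] : ∀ m Δ → m + Δ + 1 ≡ Δ + suc m
  m+Δ+1≡Δ+[1+m] = solve-∀
  spread : (Δ ≡ l) ⊎ (suc m ≤ l) → Δ C 2 + suc m C 2 ≤ l C 2 + ((Δ + suc m) ∸ l) C 2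
  spread (inj₁ refl) = ≤-reflexive (cong (λ s → Δ C 2 + s C 2) (sym (m+n∸m≡n Δ (suc m))))
  spread (inj₂ m<l)  = C2-spread-to Δ≤l m<l

happyBound-step : ∀ {m Δ l} → 2 ≤ Δ → suc l ≤ m → happyBound m l + Δ C 2 + m ≤ happyBound (m + Δ) (suc l)
happyBound-step {m} {Δ} {l} 2≤Δ l<m with m≤n⇒∃[o]m+o≡n (≤-trans (n≤1+n l) l<m)
... | p , refl = begin
  l C 2 + ((l + p + 1) ∸ l) C 2 + Δ C 2 + (l + p)
    ≡⟨ cong (λ s → l C 2 + s C 2 + Δ C 2 + (l + p))
            (trans (cong (_∸ l) (+-assoc l p 1)) (m+n∸m≡n l (p + 1))) ⟩
  l C 2 + (p + 1) C 2 + Δ C 2 + (l + p)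
    ≡⟨ cong (λ c → l C 2 + c + Δ C 2 + (l + p)) (trans (cong (_C 2) (+-comm p 1)) (C2-suc p)) ⟩
  l C 2 + (p + p C 2) + Δ C 2 + (l + p)
    ≡⟨ rearrange l p (l C 2) (p C 2) (Δ C 2) ⟩
  l + l C 2 + (p C 2 + Δ C 2 + p * 2)
    ≤⟨ +-monoʳ-≤ (l + l C 2) (+-monoʳ-≤ (p C 2 + Δ C 2) (*-monoʳ-≤ p 2≤Δ)) ⟩
  l + l C 2 + (p C 2 + Δ C 2 + p * Δ)
    ≡⟨ cong₂ _+_ (C2-suc l) (C2-+ p Δ) ⟨
  suc l C 2 + (p + Δ) C 2
    ≡⟨ cong (λ s → suc l C 2 + s C 2) (trans (cong (_∸ suc l) (shift l p Δ)) (m+n∸m≡n (suc l) (p + Δ))) ⟨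
  happyBound (l + p + Δ) (suc l) ∎
  where
  open ≤-Reasoning
  rearrange : ∀ l p lc pc dc → lc + (p + pc) + dc + (l + p) ≡ l + lc + (pc + dc + p * 2)
  rearrange = solve-∀
  shift : ∀ l p Δ → l + p + Δ + 1 ≡ suc l + (p + Δ)
  shift = solve-∀

happyCount≤happyBound : ∀ l {n} (G : SimpleGraph n) → edgeCount G ≤ 2 * l → (∀ u → degree G u ≤ l) →
                        happyCount G ≤ happyBound (edgeCount G) l
happyCount≤happyBound zero G _ deg≤0 = ≤-trans (≤-reflexive (happyCount≡0 G λ u → ≤-trans (deg≤0 u) z≤n)) z≤n
happyCount≤happyBound (suc l) {zero} G _ _ = z≤n
happyCount≤happyBound (suc l) {suc n} G k≤2l deg≤l = removeMax (Δ ≤? 1)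
  where
  open IsolateMaxDegree G
  removeMax : Dec (Δ ≤ 1) → happyCount G ≤ happyBound (edgeCount G) (suc l)
  removeMax (yes Δ≤1) = ≤-trans (≤-reflexive (Δ≤1⇒happyCount≡0 Δ≤1)) z≤n
  removeMax (no  Δ≰1) = subst (λ k → happyCount G ≤ happyBound k (suc l)) (sym k≡m+Δ)
                          (≤-trans (happyCount-isolate-≤ G a) (bound (Δ ≤? l) (suc m ≤? suc l)))
    where
    2≤Δ : 2 ≤ Δ
    2≤Δ = ≰⇒> Δ≰1
    m≤2l : m ≤ 2 * l
    m≤2l = +-cancelʳ-≤ 2 m (2 * l) (begin
      m + 2       ≤⟨ +-monoʳ-≤ m 2≤Δ ⟩
      m + Δ       ≡⟨ k≡m+Δ ⟨
      edgeCount G ≤⟨ k≤2l ⟩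
      2 * suc l   ≡⟨ trans (*-suc 2 l) (+-comm 2 (2 * l)) ⟩
      2 * l + 2   ∎)
      where open ≤-Reasoning
    bounding-H : ∀ {t} → happyCount H ≤ t → happyCount H + Δ C 2 + m ≤ t + Δ C 2 + m
    bounding-H h≤t = +-monoˡ-≤ m (+-monoˡ-≤ (Δ C 2) h≤t)
    bound : Dec (Δ ≤ l) → Dec (suc m ≤ suc l) → happyCount H + Δ C 2 + m ≤ happyBound (m + Δ) (suc l)
    bound (no Δ≰l) _ = ≤-trans (bounding-H (happyCount≤C2 H))
      (happyBound-star {m} (deg≤l a) (inj₁ (≤-antisym (deg≤l a) (≰⇒> Δ≰l))))
    bound (yes _) (yes m<l) = ≤-trans (bounding-H (happyCount≤C2 H)) (happyBound-star {m} (deg≤l a) (inj₂ m<l))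
    bound (yes Δ≤l) (no m≮l) = ≤-trans (bounding-H IH) (happyBound-step 2≤Δ (≤-pred (≰⇒> m≮l)))
      where
      IH : happyCount H ≤ happyBound m l
      IH = happyCount≤happyBound l H m≤2l (λ v → ≤-trans (degreeH≤Δ v) Δ≤l)

lemma2p2 : (k l : ℕ) → k ≤ 2 * l →
    (n : ℕ) (G : SimpleGraph n) →
    edgeCount G ≡ k →
    (∀ (u : Fin n) → degree G u ≤ l) →
    happyCount G ≤ (l C 2) + (((k + 1) ∸ l) C 2)
lemma2p2 k l k≤2l n G refl deg≤l = happyCount≤happyBound l G k≤2l deg≤l
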